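{- Let $P$ be a $1$-Sing poset of odd rank $d+1$, and let $O(P)$ be its reduced order complex. For $q\in P\setminus\{\hat0,\hat1\}$ let $v_q$ be the corresponding vertex of $O(P)$. Then \[ 2\big(\tilde\chi(O(P))+1\big)=\sum_{q\in P:\ \rho(q)\in\{1,d\}}1-\sum_{q\in P:\ \rho(q)\in\{1,d\}}\tilde\chi\big(\mathrm{lk}_{O(P)}v_q\big). \]
   Context: Posets are finite and graded with unique $\hat0$, $\hat1$, rank function $\rho$ and Möbius function $\mu$. A poset/interval is Eulerian if $\mu(s,t)=(-1)^{\rho(t)-\rho(s)}$ for all $s\le t$ in it. $P$ of rank $d+1$ is $1$-Sing if every interval $[s,t]$ of $P$ with $\rho(t)-\rho(s)\le d-1$ is Eulerian. The reduced order complex $O(P)$ is the simplicial complex with vertex set $P\setminus\{\hat0,\hat1\}$ whose faces are the chains of $P\setminus\{\hat0,\hat1\}$. $\mathrm{lk}_\Gamma v=\{G\in\Gamma: v\notin G,\ G\cup\{v\}\in\Gamma\}$ and $\tilde\chi(\Gamma)=\sum_{i\ge-1}(-1)^if_i(\Gamma)$, with $f_i$ the number of $i$-dimensional faces. -}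

module Defs where

open import Data.Bool using (Bool; true; false; _∧_; _∨_; not; if_then_else_)
open import Data.Nat as ℕ using (ℕ; zero; suc; _∸_)
open import Data.Integer as ℤ using (ℤ; +_; -_)
open import Data.Fin using (Fin)
open import Data.Fin.Subset using (Subset; _∪_; ⁅_⁆; ∣_∣)
open import Data.Vec using ([]; _∷_; lookup)
open import Data.List using (List; []; _∷_; map; filterᵇ; allFin; _++_)
open import Data.Product using (Σ; _×_; _,_)
open import Level using (0ℓ)
open import Relation.Nullary using (¬_; does)
open import Relation.Binary using (Rel; Decidable; IsPartialOrder)
open import Relation.Binary.PropositionalEquality using (_≡_; _≢_)
import Data.Fin.Properties as FinP

allB : {A : Set} → (A → Bool) → List A → Bool
allB p []       = true
allB p (x ∷ xs) = p x ∧ allB p xs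

sumℤ : List ℤ → ℤ
sumℤ []       = + 0
sumℤ (x ∷ xs) = x ℤ.+ sumℤ xs

sgn : ℕ → ℤ
sgn k = (- (+ 1)) ℤ.^ k

record FinPoset (n : ℕ) : Set₁ where
  field
    _≼_       : Rel (Fin n) 0ℓ
    _≼?_      : Decidable _≼_
    isPartialOrder : IsPartialOrder _≡_ _≼_
    bot       : Fin n
    top       : Fin n
    bot-least : ∀ x → bot ≼ x
    top-great : ∀ x → x ≼ top

  _≺_ : Fin n → Fin n → Set
  s ≺ t = (s ≼ t) × (s ≢ t)

  _⋖_ : Fin n → Fin n → Set
  s ⋖ t = (s ≺ t) × (¬ Σ (Fin n) (λ u → (s ≺ u) × (u ≺ t)))

  le? : Fin n → Fin n → Bool
  le? s t = does (s ≼? t)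

  lt? : Fin n → Fin n → Bool
  lt? s t = le? s t ∧ not (does (s FinP.≟ t))

  -- The fuel argument only bounds recursion depth;
  -- fuel n suffices since strict chains in an n-element poset have < n+1 elements.
  mobF : ℕ → Fin n → Fin n → ℤ
  mobF zero    s t = + 0
  mobF (suc k) s t =
    if does (s FinP.≟ t) then + 1
    else if le? s t
      then - sumℤ (map (mobF k s) (filterᵇ (λ u → le? s u ∧ lt? u t) (allFin n)))
      else + 0

  μ : Fin n → Fin n → ℤ
  μ = mobF n

record GradedPoset (n : ℕ) : Set₁ where
  field
    poset : FinPoset n
  open FinPoset poset public
  field
    ρ       : Fin n → ℕ
    ρ-bot   : ρ bot ≡ 0
    ρ-cover : ∀ s t → s ⋖ t → ρ t ≡ suc (ρ s)

  Eulerian : Fin n → Fin n → Set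
  Eulerian s t = ∀ x y → s ≼ x → x ≼ y → y ≼ t → μ x y ≡ sgn (ρ y ∸ ρ x)

  -- P of rank d+1 is 1-Sing: every interval of length ≤ d-1 is Eulerian
  OneSing : ℕ → Set
  OneSing d = ∀ s t → s ≼ t → (ρ t ∸ ρ s) ℕ.+ 1 ℕ.≤ d → Eulerian s t

Complex : ℕ → Set
Complex n = Subset n → Bool

allSubsets : (n : ℕ) → List (Subset n)
allSubsets zero    = [] ∷ []
allSubsets (suc n) = map (true ∷_) (allSubsets n) ++ map (false ∷_) (allSubsets n)

-- reduced Euler characteristic: Σ_F (-1)^{dim F}, dim F = |F| - 1
redEuler : ∀ {n} → Complex n → ℤ
redEuler {n} Γ = sumℤ (map (λ F → sgn (suc ∣ F ∣)) (filterᵇ (λ F → Γ F) (allSubsets n)))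

lk : ∀ {n} → Complex n → Fin n → Complex n
lk Γ v G = not (lookup G v) ∧ Γ (G ∪ ⁅ v ⁆)

orderComplex : ∀ {n} → GradedPoset n → Complex n
orderComplex {n} P F =
  allB (λ i → not (lookup F i) ∨
        (not (does (i FinP.≟ bot)) ∧ not (does (i FinP.≟ top)) ∧
         allB (λ j → not (lookup F j) ∨ le? i j ∨ le? j i) (allFin n)))
      (allFin n)
  where open GradedPoset P

rankOneOrD : ∀ {n} → GradedPoset n → ℕ → List (Fin n)
rankOneOrD {n} P d =
  filterᵇ (λ q → not (does (q FinP.≟ bot)) ∧ not (does (q FinP.≟ top)) ∧
                 (does (ρ q ℕ.≟ 1) ∨ does (ρ q ℕ.≟ d)))
          (allFin n)
  where open GradedPoset P

-- For a set S of proper elements let K(S) = Σ (-1)^|F| over the chains F ⊆ S, the empty chain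
-- included, so that χ̃(O(P)) = -K(P̄) for the proper part P̄.  Sorting the non-empty chains by
-- their largest element gives K(S) = 1 - Σ_{q ∈ S} K(S_{<q}), and by their smallest element
-- K(S) = 1 - Σ_{q ∈ S} K(S_{>q}).  The first identity also yields Hall's theorem
-- μ(s,t) = -K((s,t)), so A_q = K(P̄_{<q}) = -μ(0̂,q) and B_q = K(P̄_{>q}) = -μ(q,1̂), and adding
-- the two decompositions of K(P̄) gives 2(χ̃(O(P)) + 1) = Σ_q (A_q + B_q).  The link of v_q is
-- the join of the chains below and above q, whence χ̃(lk v_q) = -A_q B_q.  By 1-Sing,
-- A_q = -(-1)^ρ(q) unless ρ(q) = d and B_q = -(-1)^(d+1-ρ(q)) unless ρ(q) = 1; as d + 1 is
-- odd, one of A_q, B_q equals 1, so A_q + B_q = 1 + A_q B_q = 1 - χ̃(lk v_q), which vanishes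
-- unless ρ(q) ∈ {1, d}.

module Submission where

open import Defs
open import Data.Nat using (ℕ; suc; _%_)
open import Data.Integer using (ℤ; +_; _+_; _-_; _*_)
open import Data.List using (length; map)
open import Relation.Binary.PropositionalEquality using (_≡_)

open import Data.Bool using (Bool; true; false; _∧_; _∨_; not; if_then_else_)
import Data.Bool.Properties as BoolP
open import Data.Nat as ℕ using (zero; _≤_; _<_; z≤n; s≤s; _∸_)
import Data.Nat.Properties as ℕP
open import Data.Integer using (-_)
import Data.Integer.Properties as ℤP
open import Data.Fin using (Fin; zero; suc)
import Data.Fin.Properties as FinP
open import Data.Fin.Subset using (Subset; _∪_; _∩_; ⁅_⁆; ∣_∣) renaming (⊥ to ∅)
import Data.Fin.Subset.Properties as SubsetP
open import Data.Vec as Vec using ([]; _∷_; lookup)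
import Data.Vec.Properties as VecP
open import Data.List using (List; []; _∷_; filterᵇ; allFin; tabulate; _++_)
import Data.List.Properties as ListP
open import Data.List.Membership.Propositional using (_∈_)
open import Data.List.Relation.Unary.Any using (here; there)
open import Data.List.Membership.Propositional.Properties using (∈-allFin)
open import Data.Product using (Σ; _×_; _,_; proj₁; proj₂)
open import Data.Sum using (_⊎_; inj₁; inj₂; [_,_]′) renaming (map to ⊎-map)
open import Data.Empty using (⊥; ⊥-elim)
open import Function using (_∘_)
open import Relation.Nullary using (¬_; Dec; does; yes; no)
open import Relation.Nullary.Decidable using (dec-true; dec-false; does-⇔)
open import Function.Bundles using (mk⇔)
open import Relation.Binary.PropositionalEquality
  using (_≢_; refl; sym; trans; cong; cong₂; subst; module ≡-Reasoning)
open import Relation.Binary using (IsPartialOrder)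
open import Data.Integer.Tactic.RingSolver using (solve-∀)
open import Algebra.Properties.Semiring.Sum ℤP.+-*-semiring
  using (sum; sum-cong-≗; ∑-distrib-+; sum-replicate-zero; *-distribˡ-sum)
open import Algebra.Properties.CommutativeSemigroup ℤP.+-commutativeSemigroup using (interchange)

open ≡-Reasoning

∧-trueˡ : ∀ {a b} → a ∧ b ≡ true → a ≡ true
∧-trueˡ {true} _ = refl

∧-trueʳ : ∀ {a b} → a ∧ b ≡ true → b ≡ true
∧-trueʳ {true} e = e

∧-true : ∀ {a b} → a ≡ true → b ≡ true → a ∧ b ≡ true
∧-true refl refl = refl

∨-true : ∀ {a b} → a ∨ b ≡ true → a ≡ true ⊎ b ≡ true
∨-true {true}  _ = inj₁ refl
∨-true {false} e = inj₂ e

∨-trueˡ : ∀ {a b} → a ≡ true → a ∨ b ≡ true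
∨-trueˡ refl = refl

∨-trueʳ : ∀ {a b} → b ≡ true → a ∨ b ≡ true
∨-trueʳ {true}  _ = refl
∨-trueʳ {false} e = e

not-true : ∀ {a} → not a ≡ true → a ≡ false
not-true {false} _ = refl

not-false : ∀ {a} → a ≡ false → not a ≡ true
not-false refl = refl

true≢false : ∀ {a} → a ≡ true → a ≢ false
true≢false refl ()

≢true : ∀ {a} → ¬ (a ≡ true) → a ≡ false
≢true = BoolP.¬-not

∧-rearrange : ∀ a b c d → (a ∧ b) ∧ (c ∧ d) ≡ c ∧ ((a ∧ d) ∧ b)
∧-rearrange false b c     d = sym (BoolP.∧-zeroʳ c)
∧-rearrange true  b false d = BoolP.∧-zeroʳ b
∧-rearrange true  b true  d = BoolP.∧-comm b d

≡-by-⇔ : ∀ {a b} → (a ≡ true → b ≡ true) → (b ≡ true → a ≡ true) → a ≡ b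
≡-by-⇔ {true}  f _ = sym (f refl)
≡-by-⇔ {false} {true} _ g = g refl
≡-by-⇔ {false} {false} _ _ = refl

implies : ∀ a {b} → (a ≡ true → b ≡ true) → not a ∨ b ≡ true
implies true  h = h refl
implies false _ = refl

implied : ∀ {a b} → not a ∨ b ≡ true → a ≡ true → b ≡ true
implied {true} e refl = e

does-true : ∀ {p} {A : Set p} (a? : Dec A) → does a? ≡ true → A
does-true (yes a) _ = a

does-false : ∀ {p} {A : Set p} (a? : Dec A) → does a? ≡ false → ¬ A
does-false (no ¬a) _ = ¬a

ind : Bool → ℤ → ℤ
ind true  z = z
ind false _ = + 0

ind-cong : ∀ b {x y} → (b ≡ true → x ≡ y) → ind b x ≡ ind b y
ind-cong true  h = h refl
ind-cong false _ = refl

ind-zero : ∀ b → ind b (+ 0) ≡ + 0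
ind-zero true  = refl
ind-zero false = refl

ind-∧ : ∀ a b z → ind (a ∧ b) z ≡ ind a (ind b z)
ind-∧ true  _ _ = refl
ind-∧ false _ _ = refl

ind-neg : ∀ b z → ind b (- z) ≡ - ind b z
ind-neg true  _ = refl
ind-neg false _ = refl

ind-+ : ∀ b x y → ind b (x + y) ≡ ind b x + ind b y
ind-+ true  _ _ = refl
ind-+ false _ _ = refl

ind-* : ∀ a b x y → ind a x * ind b y ≡ ind (a ∧ b) (x * y)
ind-* true  true  _ _ = refl
ind-* true  false x _ = ℤP.*-zeroʳ x
ind-* false b     _ y = ℤP.*-zeroˡ (ind b y)

sgn-suc : ∀ k → sgn (suc k) ≡ - sgn k
sgn-suc k = ℤP.-1*i≡-i (sgn k)

sgn-+ : ∀ k l → sgn (k ℕ.+ l) ≡ sgn k * sgn l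
sgn-+ = ℤP.^-distribˡ-+-* (- (+ 1))

sgn-odd : ∀ k → k % 2 ≡ 1 → sgn k ≡ - (+ 1)
sgn-odd (suc zero)    _   = refl
sgn-odd (suc (suc k)) odd = trans (trans (sgn-suc (suc k)) (cong -_ (sgn-suc k)))
                                  (trans (ℤP.neg-involutive (sgn k)) (sgn-odd k odd))

sgn-±1 : ∀ k → sgn k ≡ + 1 ⊎ sgn k ≡ - (+ 1)
sgn-±1 zero    = inj₁ refl
sgn-±1 (suc k) with sgn-±1 k
... | inj₁ e = inj₂ (trans (sgn-suc k) (cong -_ e))
... | inj₂ e = inj₁ (trans (sgn-suc k) (cong -_ e))

+-unit-side : ∀ a b → a ≡ + 1 ⊎ b ≡ + 1 → a + b ≡ + 1 + a * b
+-unit-side a b (inj₁ refl) = cong (_+_ (+ 1)) (sym (ℤP.*-identityˡ b))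
+-unit-side a b (inj₂ refl) = trans (ℤP.+-comm a (+ 1)) (cong (_+_ (+ 1)) (sym (ℤP.*-identityʳ a)))

neg-*-neg : ∀ a b → - a * - b ≡ a * b
neg-*-neg = solve-∀

sum-neg : ∀ {n} (f : Fin n → ℤ) → sum (λ i → - f i) ≡ - sum f
sum-neg f = begin
  sum (λ i → - f i)         ≡⟨ sum-cong-≗ (λ i → sym (ℤP.-1*i≡-i (f i))) ⟩
  sum (λ i → - (+ 1) * f i) ≡⟨ *-distribˡ-sum (- (+ 1)) f ⟨
  - (+ 1) * sum f           ≡⟨ ℤP.-1*i≡-i (sum f) ⟩
  - sum f                   ∎

sum-δ : ∀ {n} (m : Fin n) v → sum (λ q → ind (does (q FinP.≟ m)) v) ≡ v
sum-δ {suc n} zero v = begin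
  v + sum {n} (λ _ → + 0) ≡⟨ cong (_+_ v) (sum-replicate-zero n) ⟩
  v + + 0             ≡⟨ ℤP.+-identityʳ v ⟩
  v                   ∎
sum-δ {suc n} (suc m) v = trans (ℤP.+-identityˡ _) (sum-δ m v)

sumℤ-filter : ∀ {A : Set} (p : A → Bool) (g : A → ℤ) xs →
              sumℤ (map g (filterᵇ p xs)) ≡ sumℤ (map (λ x → ind (p x) (g x)) xs)
sumℤ-filter p g []       = refl
sumℤ-filter p g (x ∷ xs) with p x
... | true  = cong (_+_ (g x)) (sumℤ-filter p g xs)
... | false = trans (sumℤ-filter p g xs) (sym (ℤP.+-identityˡ _))

length-filter : ∀ {A : Set} (p : A → Bool) xs →
                + length (filterᵇ p xs) ≡ sumℤ (map (λ x → ind (p x) (+ 1)) xs)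
length-filter p []       = refl
length-filter p (x ∷ xs) with p x
... | true  = trans (ℤP.pos-+ 1 _) (cong (_+_ (+ 1)) (length-filter p xs))
... | false = trans (length-filter p xs) (sym (ℤP.+-identityˡ _))

sumℤ-++ : ∀ xs ys → sumℤ (xs ++ ys) ≡ sumℤ xs + sumℤ ys
sumℤ-++ []       ys = sym (ℤP.+-identityˡ _)
sumℤ-++ (x ∷ xs) ys = trans (cong (_+_ x) (sumℤ-++ xs ys)) (sym (ℤP.+-assoc x _ _))

sumℤ-tabulate : ∀ {n} (f : Fin n → ℤ) → sumℤ (tabulate f) ≡ sum f
sumℤ-tabulate {zero}  f = refl
sumℤ-tabulate {suc n} f = cong (_+_ (f zero)) (sumℤ-tabulate (f ∘ suc))

sumℤ-allFin : ∀ {n} (f : Fin n → ℤ) → sumℤ (map f (allFin n)) ≡ sum f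
sumℤ-allFin f = trans (cong sumℤ (ListP.map-tabulate (λ i → i) f)) (sumℤ-tabulate f)

sumℤ-filter-allFin : ∀ {n} (p : Fin n → Bool) (g : Fin n → ℤ) →
                     sumℤ (map g (filterᵇ p (allFin n))) ≡ sum (λ u → ind (p u) (g u))
sumℤ-filter-allFin {n} p g = trans (sumℤ-filter p g (allFin n)) (sumℤ-allFin (λ u → ind (p u) (g u)))

length-filter-allFin : ∀ {n} (p : Fin n → Bool) →
                       + length (filterᵇ p (allFin n)) ≡ sum (λ u → ind (p u) (+ 1))
length-filter-allFin {n} p = trans (length-filter p (allFin n)) (sumℤ-allFin (λ u → ind (p u) (+ 1)))

sumSubsets : ∀ n → (Subset n → ℤ) → ℤ
sumSubsets zero    f = f []
sumSubsets (suc n) f = sumSubsets n (f ∘ (true ∷_)) + sumSubsets n (f ∘ (false ∷_))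

sumℤ-allSubsets : ∀ n (f : Subset n → ℤ) → sumℤ (map f (allSubsets n)) ≡ sumSubsets n f
sumℤ-allSubsets zero    f = ℤP.+-identityʳ _
sumℤ-allSubsets (suc n) f = begin
  sumℤ (map f (ins ++ outs))                      ≡⟨ cong sumℤ (ListP.map-++ f ins outs) ⟩
  sumℤ (map f ins ++ map f outs)                  ≡⟨ sumℤ-++ (map f ins) (map f outs) ⟩
  sumℤ (map f ins) + sumℤ (map f outs)            ≡⟨ cong₂ _+_ (half true) (half false) ⟩
  sumSubsets (suc n) f                            ∎
  where
  ins  = map (true ∷_) (allSubsets n)
  outs = map (false ∷_) (allSubsets n)
  half : ∀ b → sumℤ (map f (map (b ∷_) (allSubsets n))) ≡ sumSubsets n (f ∘ (b ∷_))
  half b = trans (cong sumℤ (sym (ListP.map-∘ (allSubsets n)))) (sumℤ-allSubsets n (f ∘ (b ∷_)))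

redEuler-sumSubsets : ∀ {n} (Γ : Complex n) → redEuler Γ ≡ sumSubsets n (λ F → ind (Γ F) (sgn (suc ∣ F ∣)))
redEuler-sumSubsets {n} Γ = trans (sumℤ-filter Γ (λ F → sgn (suc ∣ F ∣)) (allSubsets n)) (sumℤ-allSubsets n _)

sumSubsets-cong : ∀ n {f g : Subset n → ℤ} → (∀ F → f F ≡ g F) → sumSubsets n f ≡ sumSubsets n g
sumSubsets-cong zero    e = e []
sumSubsets-cong (suc n) e = cong₂ _+_ (sumSubsets-cong n (e ∘ (true ∷_))) (sumSubsets-cong n (e ∘ (false ∷_)))

sumSubsets-distrib-+ : ∀ n (f g : Subset n → ℤ) →
                       sumSubsets n (λ F → f F + g F) ≡ sumSubsets n f + sumSubsets n g
sumSubsets-distrib-+ zero    f g = refl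
sumSubsets-distrib-+ (suc n) f g = trans
  (cong₂ _+_ (sumSubsets-distrib-+ n (f ∘ (true ∷_)) (g ∘ (true ∷_)))
             (sumSubsets-distrib-+ n (f ∘ (false ∷_)) (g ∘ (false ∷_))))
  (interchange (sumSubsets n (f ∘ (true ∷_))) _ (sumSubsets n (f ∘ (false ∷_))) _)

sumSubsets-zero : ∀ n → sumSubsets n (λ _ → + 0) ≡ + 0
sumSubsets-zero zero    = refl
sumSubsets-zero (suc n) = cong₂ _+_ (sumSubsets-zero n) (sumSubsets-zero n)

sumSubsets-neg : ∀ n (f : Subset n → ℤ) → sumSubsets n (λ F → - f F) ≡ - sumSubsets n f
sumSubsets-neg zero    f = refl
sumSubsets-neg (suc n) f = trans
  (cong₂ _+_ (sumSubsets-neg n (f ∘ (true ∷_))) (sumSubsets-neg n (f ∘ (false ∷_))))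
  (sym (ℤP.neg-distrib-+ (sumSubsets n (f ∘ (true ∷_))) _))

sumSubsets-ind : ∀ n b (f : Subset n → ℤ) → sumSubsets n (λ F → ind b (f F)) ≡ ind b (sumSubsets n f)
sumSubsets-ind n true  f = refl
sumSubsets-ind n false f = sumSubsets-zero n

sumSubsets-comm : ∀ n {m} (g : Subset n → Fin m → ℤ) →
                  sumSubsets n (λ F → sum (g F)) ≡ sum (λ q → sumSubsets n (λ F → g F q))
sumSubsets-comm n {zero}  g = sumSubsets-zero n
sumSubsets-comm n {suc m} g = trans
  (sumSubsets-distrib-+ n (λ F → g F zero) (λ F → sum (g F ∘ suc)))
  (cong (_+_ (sumSubsets n (λ F → g F zero))) (sumSubsets-comm n (λ F → g F ∘ suc)))

infix 7 _⊆ᵇ_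
infixl 8 _∩ᵇ_

_⊆ᵇ_ : ∀ {n} → Subset n → (Fin n → Bool) → Bool
[]      ⊆ᵇ S = true
(x ∷ F) ⊆ᵇ S = (not x ∨ S zero) ∧ (F ⊆ᵇ S ∘ suc)

_∩ᵇ_ : ∀ {n} → Subset n → (Fin n → Bool) → Subset n
G ∩ᵇ L = G ∩ Vec.tabulate L

⊆ᵇ-elim : ∀ {n} (F : Subset n) S → F ⊆ᵇ S ≡ true → ∀ i → lookup F i ≡ true → S i ≡ true
⊆ᵇ-elim (true ∷ F) S e zero    _  = ∧-trueˡ e
⊆ᵇ-elim (x ∷ F)    S e (suc i) Fi = ⊆ᵇ-elim F (S ∘ suc) (∧-trueʳ {not x ∨ S zero} e) i Fi

⊆ᵇ-intro : ∀ {n} (F : Subset n) S → (∀ i → lookup F i ≡ true → S i ≡ true) → F ⊆ᵇ S ≡ true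
⊆ᵇ-intro []          S h = refl
⊆ᵇ-intro (true ∷ F)  S h = ∧-true (h zero refl) (⊆ᵇ-intro F (S ∘ suc) (h ∘ suc))
⊆ᵇ-intro (false ∷ F) S h = ⊆ᵇ-intro F (S ∘ suc) (h ∘ suc)

⊆ᵇ-cong : ∀ {n} (F : Subset n) {S S′} → (∀ i → S i ≡ S′ i) → F ⊆ᵇ S ≡ F ⊆ᵇ S′
⊆ᵇ-cong F {S} {S′} eq =
  ≡-by-⇔ (λ e → ⊆ᵇ-intro F S′ (λ i Fi → trans (sym (eq i)) (⊆ᵇ-elim F S e i Fi)))
         (λ e → ⊆ᵇ-intro F S  (λ i Fi → trans (eq i) (⊆ᵇ-elim F S′ e i Fi)))

⊆ᵇ-∧ : ∀ {n} (F : Subset n) S T → F ⊆ᵇ (λ i → S i ∧ T i) ≡ F ⊆ᵇ S ∧ F ⊆ᵇ T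
⊆ᵇ-∧ F S T = ≡-by-⇔
  (λ e → ∧-true (⊆ᵇ-intro F S (λ i Fi → ∧-trueˡ (⊆ᵇ-elim F _ e i Fi)))
                (⊆ᵇ-intro F T (λ i Fi → ∧-trueʳ {S i} (⊆ᵇ-elim F _ e i Fi))))
  (λ e → ⊆ᵇ-intro F _ (λ i Fi → ∧-true (⊆ᵇ-elim F S (∧-trueˡ e) i Fi)
                                       (⊆ᵇ-elim F T (∧-trueʳ {F ⊆ᵇ S} e) i Fi)))

∅ᵇ : ∀ {n} → Fin n → Bool
∅ᵇ _ = false

⊆∅-elim : ∀ {n} (F : Subset n) → F ⊆ᵇ ∅ᵇ ≡ true → ∀ i → lookup F i ≡ false
⊆∅-elim F e i = ≢true (λ Fi → true≢false (⊆ᵇ-elim F ∅ᵇ e i Fi) refl)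

⊈∅-witness : ∀ {n} (F : Subset n) → F ⊆ᵇ ∅ᵇ ≡ false → Σ (Fin n) (λ i → lookup F i ≡ true)
⊈∅-witness (true ∷ F)  e = zero , refl
⊈∅-witness (false ∷ F) e with ⊈∅-witness F e
... | i , Fi = suc i , Fi

sumSubsets-⊆∅ : ∀ n (f : Subset n → ℤ) → sumSubsets n (λ F → ind (F ⊆ᵇ ∅ᵇ) (f F)) ≡ f ∅
sumSubsets-⊆∅ zero    f = refl
sumSubsets-⊆∅ (suc n) f = trans (cong₂ _+_ (sumSubsets-zero n) (sumSubsets-⊆∅ n (f ∘ (false ∷_))))
                                (ℤP.+-identityˡ _)

lookup-⁅⁆ : ∀ {n} (q i : Fin n) → lookup ⁅ q ⁆ i ≡ does (i FinP.≟ q)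
lookup-⁅⁆ zero    zero    = refl
lookup-⁅⁆ zero    (suc i) = VecP.lookup-replicate i false
lookup-⁅⁆ (suc q) zero    = refl
lookup-⁅⁆ (suc q) (suc i) = lookup-⁅⁆ q i

lookup-∪⁅⁆ : ∀ {n} (G : Subset n) q i → lookup (G ∪ ⁅ q ⁆) i ≡ lookup G i ∨ does (i FinP.≟ q)
lookup-∪⁅⁆ G q i = trans (VecP.lookup-zipWith _∨_ i G ⁅ q ⁆) (cong (lookup G i ∨_) (lookup-⁅⁆ q i))

∪⁅⁆-inv : ∀ {n} (G : Subset n) q i → lookup (G ∪ ⁅ q ⁆) i ≡ true → lookup G i ≡ true ⊎ i ≡ q
∪⁅⁆-inv G q i e with ∨-true (trans (sym (lookup-∪⁅⁆ G q i)) e)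
... | inj₁ Gi = inj₁ Gi
... | inj₂ i≡q = inj₂ (does-true (i FinP.≟ q) i≡q)

∪⁅⁆-⊇ : ∀ {n} (G : Subset n) q {i} → lookup G i ≡ true → lookup (G ∪ ⁅ q ⁆) i ≡ true
∪⁅⁆-⊇ G q {i} Gi = trans (lookup-∪⁅⁆ G q i) (∨-trueˡ Gi)

∪⁅⁆-∋ : ∀ {n} (G : Subset n) q → lookup (G ∪ ⁅ q ⁆) q ≡ true
∪⁅⁆-∋ G q = trans (lookup-∪⁅⁆ G q q) (∨-trueʳ (dec-true (q FinP.≟ q) refl))

∣∪⁅⁆∣ : ∀ {n} (G : Subset n) q → lookup G q ≡ false → ∣ G ∪ ⁅ q ⁆ ∣ ≡ suc ∣ G ∣
∣∪⁅⁆∣ (false ∷ G) zero    _ = cong (suc ∘ ∣_∣) (SubsetP.∪-identityʳ G)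
∣∪⁅⁆∣ (true ∷ G)  (suc q) e = cong suc (∣∪⁅⁆∣ G q e)
∣∪⁅⁆∣ (false ∷ G) (suc q) e = ∣∪⁅⁆∣ G q e

sumSubsets-∋ : ∀ n (q : Fin n) (φ : Subset n → ℤ) →
  sumSubsets n (λ F → ind (lookup F q) (φ F))
    ≡ sumSubsets n (λ G → ind (not (lookup G q)) (φ (G ∪ ⁅ q ⁆)))
sumSubsets-∋ (suc n) zero φ = begin
  sumSubsets n (φ ∘ (true ∷_)) + sumSubsets n (λ _ → + 0)
    ≡⟨ cong₂ _+_ (sumSubsets-cong n (λ G → cong (φ ∘ (true ∷_)) (sym (SubsetP.∪-identityʳ G))))
                 (sumSubsets-zero n) ⟩
  φ∪ + + 0          ≡⟨ ℤP.+-comm φ∪ (+ 0) ⟩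
  + 0 + φ∪          ≡⟨ cong (_+ φ∪) (sym (sumSubsets-zero n)) ⟩
  sumSubsets n (λ _ → + 0) + φ∪ ∎
  where φ∪ = sumSubsets n (λ G → φ (true ∷ (G ∪ ∅)))
sumSubsets-∋ (suc n) (suc q) φ =
  cong₂ _+_ (sumSubsets-∋ n q (φ ∘ (true ∷_))) (sumSubsets-∋ n q (φ ∘ (false ∷_)))

lookup-∩ᵇ : ∀ {n} (G : Subset n) L i → lookup (G ∩ᵇ L) i ≡ lookup G i ∧ L i
lookup-∩ᵇ G L i = trans (VecP.lookup-zipWith _∧_ i G (Vec.tabulate L))
                        (cong (lookup G i ∧_) (VecP.lookup∘tabulate L i))

∣∩ᵇ∣-split : ∀ {n} (G : Subset n) L U → (∀ i → L i ∧ U i ≡ false) →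
             G ⊆ᵇ (λ i → L i ∨ U i) ≡ true → ∣ G ∣ ≡ ∣ G ∩ᵇ L ∣ ℕ.+ ∣ G ∩ᵇ U ∣
∣∩ᵇ∣-split []          L U _  _ = refl
∣∩ᵇ∣-split (false ∷ G) L U dj e = ∣∩ᵇ∣-split G (L ∘ suc) (U ∘ suc) (dj ∘ suc) e
∣∩ᵇ∣-split (true ∷ G)  L U dj e
  with ∣∩ᵇ∣-split G (L ∘ suc) (U ∘ suc) (dj ∘ suc) (∧-trueʳ {L zero ∨ U zero} e)
     | L zero | U zero | dj zero | ∧-trueˡ {L zero ∨ U zero} e
... | ih | true  | false | _  | _  = cong suc ih
... | ih | false | true  | _  | _  = trans (cong suc ih) (sym (ℕP.+-suc _ _))
... | _  | true  | true  | () | _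
... | _  | false | false | _  | ()

sumOver : ∀ n → (Fin n → Bool) → (Subset n → ℤ) → ℤ
sumOver n S a = sumSubsets n (λ A → ind (A ⊆ᵇ S) (a A))

sumOver-cong : ∀ n {S S′} (a : Subset n → ℤ) → (∀ i → S i ≡ S′ i) → sumOver n S a ≡ sumOver n S′ a
sumOver-cong n a eq = sumSubsets-cong n (λ A → cong (λ b → ind b (a A)) (⊆ᵇ-cong A eq))

sumOver-suc : ∀ n S (a : Subset (suc n) → ℤ) →
  sumOver (suc n) S a
    ≡ ind (S zero) (sumOver n (S ∘ suc) (a ∘ (true ∷_))) + sumOver n (S ∘ suc) (a ∘ (false ∷_))
sumOver-suc n S a = cong (_+ sumOver n (S ∘ suc) (a ∘ (false ∷_)))
  (trans (sumSubsets-cong n (λ A → ind-∧ (S zero) _ _)) (sumSubsets-ind n (S zero) _))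

ind-comm : ∀ a b z → ind a (ind b z) ≡ ind b (ind a z)
ind-comm true  b z = refl
ind-comm false b z = sym (ind-zero b)

sumOver-head : ∀ n S c (a : Subset (suc n) → ℤ) →
  sumOver n S (λ A → ind c (a (true ∷ A)) + a (false ∷ A))
    ≡ ind c (sumOver n S (a ∘ (true ∷_))) + sumOver n S (a ∘ (false ∷_))
sumOver-head n S c a = begin
  sumOver n S (λ A → ind c (a (true ∷ A)) + a (false ∷ A))
    ≡⟨ sumSubsets-cong n (λ A → trans (ind-+ (A ⊆ᵇ S) _ _) (cong (_+ _) (ind-comm (A ⊆ᵇ S) c _))) ⟩
  sumSubsets n (λ A → ind c (ind (A ⊆ᵇ S) (a (true ∷ A))) + ind (A ⊆ᵇ S) (a (false ∷ A)))
    ≡⟨ sumSubsets-distrib-+ n _ _ ⟩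
  sumSubsets n (λ A → ind c (ind (A ⊆ᵇ S) (a (true ∷ A)))) + sumOver n S (a ∘ (false ∷_))
    ≡⟨ cong (_+ sumOver n S (a ∘ (false ∷_))) (sumSubsets-ind n c _) ⟩
  ind c (sumOver n S (a ∘ (true ∷_))) + sumOver n S (a ∘ (false ∷_)) ∎

ind-pull : ∀ c X p r → ind c (ind X p) + ind X r ≡ ind X (ind c p + r)
ind-pull c true  p r = refl
ind-pull c false p r = cong (_+ + 0) (ind-zero c)

split-head : ∀ l u (a b : Bool → ℤ) → l ∧ u ≡ false →
  ind (l ∨ u) (a l * b u) + a false * b false ≡ (ind l (a true) + a false) * (ind u (b true) + b false)
split-head true  false a b _ = distribʳ (a true) (a false) (b false)
  where
  distribʳ : ∀ x y z → x * z + y * z ≡ (x + y) * (+ 0 + z)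
  distribʳ = solve-∀
split-head false true  a b _ = distribˡ (a false) (b true) (b false)
  where
  distribˡ : ∀ x y z → x * y + x * z ≡ (+ 0 + x) * (y + z)
  distribˡ = solve-∀
split-head false false a b _ = zero-pad (a false) (b false)
  where
  zero-pad : ∀ x y → + 0 + x * y ≡ (+ 0 + x) * (+ 0 + y)
  zero-pad = solve-∀

sumOver-split : ∀ n L U → (∀ i → L i ∧ U i ≡ false) → (a b : Subset n → ℤ) →
  sumOver n (λ i → L i ∨ U i) (λ G → a (G ∩ᵇ L) * b (G ∩ᵇ U)) ≡ sumOver n L a * sumOver n U b
sumOver-split zero    L U dj a b = refl
sumOver-split (suc n) L U dj a b = begin
  sumOver (suc n) (λ i → L i ∨ U i) f
    ≡⟨ sumOver-suc n (λ i → L i ∨ U i) f ⟩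
  ind c (sumOver n LU′ (f ∘ (true ∷_))) + sumOver n LU′ (f ∘ (false ∷_))
    ≡⟨ cong (_+ sumOver n LU′ (f ∘ (false ∷_))) (sumSubsets-ind n c _) ⟨
  sumSubsets n (λ G → ind c (ind (X G) (f (true ∷ G)))) + sumOver n LU′ (f ∘ (false ∷_))
    ≡⟨ sumSubsets-distrib-+ n _ _ ⟨
  sumSubsets n (λ G → ind c (ind (X G) (f (true ∷ G))) + ind (X G) (f (false ∷ G)))
    ≡⟨ sumSubsets-cong n (λ G → trans (ind-pull c (X G) _ _) (cong (ind (X G))
         (split-head (L zero) (U zero) (λ x → a (x ∷ G ∩ᵇ L′)) (λ y → b (y ∷ G ∩ᵇ U′)) (dj zero)))) ⟩
  sumOver n LU′ (λ G → a′ (G ∩ᵇ L′) * b′ (G ∩ᵇ U′))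
    ≡⟨ sumOver-split n L′ U′ (dj ∘ suc) a′ b′ ⟩
  sumOver n L′ a′ * sumOver n U′ b′
    ≡⟨ cong₂ _*_ (trans (sumOver-head n L′ (L zero) a) (sym (sumOver-suc n L a)))
                 (trans (sumOver-head n U′ (U zero) b) (sym (sumOver-suc n U b))) ⟩
  sumOver (suc n) L a * sumOver (suc n) U b ∎
  where
  f : Subset (suc n) → ℤ
  f G = a (G ∩ᵇ L) * b (G ∩ᵇ U)
  c = L zero ∨ U zero
  L′ = L ∘ suc
  U′ = U ∘ suc
  LU′ = λ i → L′ i ∨ U′ i
  X : Subset n → Bool
  X G = G ⊆ᵇ LU′
  a′ b′ : Subset n → ℤ
  a′ A = ind (L zero) (a (true ∷ A)) + a (false ∷ A)
  b′ B = ind (U zero) (b (true ∷ B)) + b (false ∷ B)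

allB-tabulate⁻ : ∀ {m k} (p : Fin k → Bool) (g : Fin m → Fin k) →
                 allB p (tabulate g) ≡ true → ∀ i → p (g i) ≡ true
allB-tabulate⁻ p g e zero    = ∧-trueˡ e
allB-tabulate⁻ p g e (suc i) = allB-tabulate⁻ p (g ∘ suc) (∧-trueʳ {p (g zero)} e) i

allB-tabulate⁺ : ∀ {m k} (p : Fin k → Bool) (g : Fin m → Fin k) →
                 (∀ i → p (g i) ≡ true) → allB p (tabulate g) ≡ true
allB-tabulate⁺ {zero}  p g h = refl
allB-tabulate⁺ {suc m} p g h = ∧-true (h zero) (allB-tabulate⁺ p (g ∘ suc) (h ∘ suc))

allB-allFin⁻ : ∀ {n} (p : Fin n → Bool) → allB p (allFin n) ≡ true → ∀ i → p i ≡ true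
allB-allFin⁻ p = allB-tabulate⁻ p (λ i → i)

allB-allFin⁺ : ∀ {n} (p : Fin n → Bool) → (∀ i → p i ≡ true) → allB p (allFin n) ≡ true
allB-allFin⁺ p = allB-tabulate⁺ p (λ i → i)

module Chains {n : ℕ} (le : Fin n → Fin n → Bool)
  (le-refl    : ∀ i → le i i ≡ true)
  (le-antisym : ∀ i j → le i j ≡ true → le j i ≡ true → i ≡ j)
  (le-trans   : ∀ i j k → le i j ≡ true → le j k ≡ true → le i k ≡ true) where

  lt : Fin n → Fin n → Bool
  lt i j = le i j ∧ not (does (i FinP.≟ j))

  lt-irrefl : ∀ i → lt i i ≡ false
  lt-irrefl i = trans (cong (λ b → le i i ∧ not b) (dec-true (i FinP.≟ i) refl)) (BoolP.∧-zeroʳ (le i i))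

  comparable : Fin n → Fin n → Bool
  comparable i j = le i j ∨ le j i

  comparableWithin : Subset n → Fin n → Bool
  comparableWithin F i = allB (λ j → not (lookup F j) ∨ comparable i j) (allFin n)

  isChain : Subset n → Bool
  isChain F = allB (λ i → not (lookup F i) ∨ comparableWithin F i) (allFin n)

  isChain⁻ : ∀ F → isChain F ≡ true → ∀ i j → lookup F i ≡ true → lookup F j ≡ true → comparable i j ≡ true
  isChain⁻ F e i j Fi Fj =
    implied (allB-allFin⁻ _ (implied (allB-allFin⁻ _ e i) Fi) j) Fj

  isChain⁺ : ∀ F → (∀ i j → lookup F i ≡ true → lookup F j ≡ true → comparable i j ≡ true) → isChain F ≡ true
  isChain⁺ F h = allB-allFin⁺ _ (λ i → implies (lookup F i) (λ Fi →
                   allB-allFin⁺ _ (λ j → implies (lookup F j) (h i j Fi))))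

  isChainIn : (Fin n → Bool) → Subset n → Bool
  isChainIn S F = F ⊆ᵇ S ∧ isChain F

  chainWeight : Subset n → ℤ
  chainWeight F = ind (isChain F) (sgn ∣ F ∣)

  chainSum : (Fin n → Bool) → ℤ
  chainSum S = sumOver n S chainWeight

  lt⇒≢ : ∀ {i j} → lt i j ≡ true → i ≢ j
  lt⇒≢ {i} e refl = true≢false e (lt-irrefl i)

  lt⇒le : ∀ {i j} → lt i j ≡ true → le i j ≡ true
  lt⇒le = ∧-trueˡ

  le⇒lt : ∀ {i j} → le i j ≡ true → i ≢ j → lt i j ≡ true
  le⇒lt {i} {j} e i≢j = ∧-true e (not-false (dec-false (i FinP.≟ j) i≢j))

  lt-le-asym : ∀ {i j} → lt i j ≡ true → le j i ≡ true → ⊥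
  lt-le-asym {i} {j} e e′ = lt⇒≢ e (le-antisym i j (lt⇒le e) e′)

  isChain-⊆ : ∀ F H → (∀ i → lookup H i ≡ true → lookup F i ≡ true) → isChain F ≡ true → isChain H ≡ true
  isChain-⊆ F H H⊆F e = isChain⁺ H (λ i j Hi Hj → isChain⁻ F e i j (H⊆F i Hi) (H⊆F j Hj))

  ∩ᵇ⁻ : ∀ (G : Subset n) L {i} → lookup (G ∩ᵇ L) i ≡ true → lookup G i ≡ true × L i ≡ true
  ∩ᵇ⁻ G L {i} e = let e′ = trans (sym (lookup-∩ᵇ G L i)) e in ∧-trueˡ e′ , ∧-trueʳ {lookup G i} e′

  ∩ᵇ⁺ : ∀ (G : Subset n) L {i} → lookup G i ≡ true → L i ≡ true → lookup (G ∩ᵇ L) i ≡ true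
  ∩ᵇ⁺ G L {i} Gi Li = trans (lookup-∩ᵇ G L i) (∧-true Gi Li)

  below above : (Fin n → Bool) → Fin n → Fin n → Bool
  below S q i = S i ∧ lt i q
  above S q i = S i ∧ lt q i

  below-above-disjoint : ∀ S q i → below S q i ∧ above S q i ≡ false
  below-above-disjoint S q i = ≢true (λ e →
    lt-le-asym (∧-trueʳ {S i} (∧-trueˡ e)) (lt⇒le (∧-trueʳ {S i} (∧-trueʳ {below S q i} e))))

  module _ (S : Fin n → Bool) (q : Fin n) (G : Subset n) (q∉G : lookup G q ≡ false) where

    private
      L U : Fin n → Bool
      L = below S q
      U = above S q

      ∈G⇒≢q : ∀ {i} → lookup G i ≡ true → i ≢ q
      ∈G⇒≢q Gi refl = true≢false Gi q∉G

    isChainIn-∪⁅⁆⇒ : isChainIn S (G ∪ ⁅ q ⁆) ≡ true →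
                     G ⊆ᵇ (λ i → L i ∨ U i) ∧ (isChain (G ∩ᵇ L) ∧ isChain (G ∩ᵇ U)) ≡ true
    isChainIn-∪⁅⁆⇒ e = ∧-true (⊆ᵇ-intro G _ G⊆L∪U) (∧-true (chain-part L) (chain-part U))
      where
      V = G ∪ ⁅ q ⁆
      V⊆S = ⊆ᵇ-elim V S (∧-trueˡ e)
      V-chain = ∧-trueʳ {V ⊆ᵇ S} e
      G⊆L∪U : ∀ i → lookup G i ≡ true → L i ∨ U i ≡ true
      G⊆L∪U i Gi with ∨-true (isChain⁻ V V-chain i q (∪⁅⁆-⊇ G q Gi) (∪⁅⁆-∋ G q))
      ... | inj₁ i≤q = ∨-trueˡ (∧-true (V⊆S i (∪⁅⁆-⊇ G q Gi)) (le⇒lt i≤q (∈G⇒≢q Gi)))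
      ... | inj₂ q≤i = ∨-trueʳ (∧-true (V⊆S i (∪⁅⁆-⊇ G q Gi)) (le⇒lt q≤i (∈G⇒≢q Gi ∘ sym)))
      chain-part : ∀ W → isChain (G ∩ᵇ W) ≡ true
      chain-part W = isChain-⊆ V (G ∩ᵇ W) (λ i e′ → ∪⁅⁆-⊇ G q (proj₁ (∩ᵇ⁻ G W e′))) V-chain

    isChainIn-∪⁅⁆⇐ : S q ≡ true →
                     G ⊆ᵇ (λ i → L i ∨ U i) ∧ (isChain (G ∩ᵇ L) ∧ isChain (G ∩ᵇ U)) ≡ true →
                     isChainIn S (G ∪ ⁅ q ⁆) ≡ true
    isChainIn-∪⁅⁆⇐ Sq e = ∧-true (⊆ᵇ-intro V S V⊆S) (isChain⁺ V V-chain)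
      where
      V = G ∪ ⁅ q ⁆
      G⊆L∪U = ⊆ᵇ-elim G _ (∧-trueˡ e)
      L-chain = ∧-trueˡ (∧-trueʳ {G ⊆ᵇ (λ i → L i ∨ U i)} e)
      U-chain = ∧-trueʳ {isChain (G ∩ᵇ L)} (∧-trueʳ {G ⊆ᵇ (λ i → L i ∨ U i)} e)
      V⊆S : ∀ i → lookup V i ≡ true → S i ≡ true
      V⊆S i Vi with ∪⁅⁆-inv G q i Vi
      ... | inj₁ Gi   = [ ∧-trueˡ , ∧-trueˡ ]′ (∨-true (G⊆L∪U i Gi))
      ... | inj₂ refl = Sq
      side : ∀ {i} → lookup G i ≡ true → lt i q ≡ true ⊎ lt q i ≡ true
      side {i} Gi = ⊎-map (∧-trueʳ {S i}) (∧-trueʳ {S i}) (∨-true (G⊆L∪U i Gi))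
      G-chain : ∀ i j → lookup G i ≡ true → lookup G j ≡ true → comparable i j ≡ true
      G-chain i j Gi Gj with ∨-true (G⊆L∪U i Gi) | ∨-true (G⊆L∪U j Gj)
      ... | inj₁ Li | inj₁ Lj = isChain⁻ (G ∩ᵇ L) L-chain i j (∩ᵇ⁺ G L Gi Li) (∩ᵇ⁺ G L Gj Lj)
      ... | inj₂ Ui | inj₂ Uj = isChain⁻ (G ∩ᵇ U) U-chain i j (∩ᵇ⁺ G U Gi Ui) (∩ᵇ⁺ G U Gj Uj)
      ... | inj₁ Li | inj₂ Uj = ∨-trueˡ (le-trans i q j (lt⇒le (∧-trueʳ {S i} Li)) (lt⇒le (∧-trueʳ {S j} Uj)))
      ... | inj₂ Ui | inj₁ Lj = ∨-trueʳ (le-trans j q i (lt⇒le (∧-trueʳ {S j} Lj)) (lt⇒le (∧-trueʳ {S i} Ui)))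
      q-comparable : ∀ {i} → lookup G i ≡ true → comparable i q ≡ true × comparable q i ≡ true
      q-comparable Gi with side Gi
      ... | inj₁ i<q = ∨-trueˡ (lt⇒le i<q) , ∨-trueʳ (lt⇒le i<q)
      ... | inj₂ q<i = ∨-trueʳ (lt⇒le q<i) , ∨-trueˡ (lt⇒le q<i)
      V-chain : ∀ i j → lookup V i ≡ true → lookup V j ≡ true → comparable i j ≡ true
      V-chain i j Vi Vj with ∪⁅⁆-inv G q i Vi | ∪⁅⁆-inv G q j Vj
      ... | inj₁ Gi   | inj₁ Gj   = G-chain i j Gi Gj
      ... | inj₁ Gi   | inj₂ refl = proj₁ (q-comparable Gi)
      ... | inj₂ refl | inj₁ Gj   = proj₂ (q-comparable Gj)
      ... | inj₂ refl | inj₂ refl = ∨-trueˡ (le-refl q)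

  chainSum-through-term : ∀ S q → S q ≡ true → ∀ G →
    ind (not (lookup G q)) (ind (isChainIn S (G ∪ ⁅ q ⁆)) (sgn ∣ G ∪ ⁅ q ⁆ ∣))
      ≡ - ind (G ⊆ᵇ (λ i → below S q i ∨ above S q i))
              (chainWeight (G ∩ᵇ below S q) * chainWeight (G ∩ᵇ above S q))
  chainSum-through-term S q Sq G with lookup G q in q∈G?
  ... | true = cong -_ (sym (cong (λ b → ind b (chainWeight (G ∩ᵇ below S q) * chainWeight (G ∩ᵇ above S q)))
                                 q∉L∪U))
    where
    q∉L∪U : G ⊆ᵇ (λ i → below S q i ∨ above S q i) ≡ false
    q∉L∪U = ≢true (λ e → [ (λ x → true≢false (∧-trueʳ {S q} x) (lt-irrefl q))
                         , (λ x → true≢false (∧-trueʳ {S q} x) (lt-irrefl q)) ]′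
                         (∨-true (⊆ᵇ-elim G _ e q q∈G?)))
  ... | false = begin
    ind (isChainIn S (G ∪ ⁅ q ⁆)) (sgn ∣ G ∪ ⁅ q ⁆ ∣)
      ≡⟨ cong₂ ind (≡-by-⇔ (isChainIn-∪⁅⁆⇒ S q G q∈G?) (isChainIn-∪⁅⁆⇐ S q G q∈G? Sq))
                   (trans (cong sgn (∣∪⁅⁆∣ G q q∈G?)) (sgn-suc ∣ G ∣)) ⟩
    ind (Y ∧ (c₁ ∧ c₂)) (- sgn ∣ G ∣)
      ≡⟨ ind-∧ Y (c₁ ∧ c₂) _ ⟩
    ind Y (ind (c₁ ∧ c₂) (- sgn ∣ G ∣))
      ≡⟨ ind-cong Y (λ y → cong (ind (c₁ ∧ c₂) ∘ -_)
           (trans (cong sgn (∣∩ᵇ∣-split G L U (below-above-disjoint S q) y)) (sgn-+ ∣ G ∩ᵇ L ∣ _))) ⟩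
    ind Y (ind (c₁ ∧ c₂) (- (sgn ∣ G ∩ᵇ L ∣ * sgn ∣ G ∩ᵇ U ∣)))
      ≡⟨ cong (ind Y) (trans (ind-neg (c₁ ∧ c₂) _) (cong -_ (sym (ind-* c₁ c₂ _ _)))) ⟩
    ind Y (- (chainWeight (G ∩ᵇ L) * chainWeight (G ∩ᵇ U)))
      ≡⟨ ind-neg Y _ ⟩
    - ind Y (chainWeight (G ∩ᵇ L) * chainWeight (G ∩ᵇ U)) ∎
    where
    L = below S q
    U = above S q
    Y = G ⊆ᵇ (λ i → L i ∨ U i)
    c₁ = isChain (G ∩ᵇ L)
    c₂ = isChain (G ∩ᵇ U)

  chainSum-through : ∀ S q → S q ≡ true →
    sumSubsets n (λ F → ind (lookup F q) (ind (isChainIn S F) (sgn ∣ F ∣)))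
      ≡ - (chainSum (below S q) * chainSum (above S q))
  chainSum-through S q Sq = begin
    sumSubsets n (λ F → ind (lookup F q) (ind (isChainIn S F) (sgn ∣ F ∣)))
      ≡⟨ sumSubsets-∋ n q _ ⟩
    sumSubsets n (λ G → ind (not (lookup G q)) (ind (isChainIn S (G ∪ ⁅ q ⁆)) (sgn ∣ G ∪ ⁅ q ⁆ ∣)))
      ≡⟨ sumSubsets-cong n (chainSum-through-term S q Sq) ⟩
    sumSubsets n (λ G → - ind (G ⊆ᵇ (λ i → L i ∨ U i)) (chainWeight (G ∩ᵇ L) * chainWeight (G ∩ᵇ U)))
      ≡⟨ sumSubsets-neg n _ ⟩
    - sumOver n (λ i → L i ∨ U i) (λ G → chainWeight (G ∩ᵇ L) * chainWeight (G ∩ᵇ U))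
      ≡⟨ cong -_ (sumOver-split n L U (below-above-disjoint S q) chainWeight chainWeight) ⟩
    - (chainSum L * chainSum U) ∎
    where
    L = below S q
    U = above S q

  ⊆∅-isChainIn : ∀ S F → F ⊆ᵇ ∅ᵇ ≡ true → isChainIn S F ≡ true
  ⊆∅-isChainIn S F e = ∧-true (⊆ᵇ-intro F S (λ i Fi → ⊥-elim (true≢false Fi (⊆∅-elim F e i))))
                              (isChain⁺ F (λ i j Fi _ → ⊥-elim (true≢false Fi (⊆∅-elim F e i))))

  chainSum-∅ : chainSum ∅ᵇ ≡ + 1
  chainSum-∅ = trans (sumSubsets-⊆∅ n chainWeight)
                     (cong₂ ind (∧-trueʳ {∅ {n} ⊆ᵇ ∅ᵇ} (⊆∅-isChainIn ∅ᵇ ∅ (⊆ᵇ-intro ∅ ∅ᵇ ∅-empty)))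
                                (cong sgn (SubsetP.∣⊥∣≡0 n)))
    where
    ∅-empty : ∀ i → lookup (∅ {n}) i ≡ true → false ≡ true
    ∅-empty i e = trans (sym (VecP.lookup-replicate i false)) e

  isMax : Subset n → Fin n → Bool
  isMax F q = lookup F q ∧ F ⊆ᵇ (λ i → le i q)

  module _ (F : Subset n) where

    scanMax : Fin n → List (Fin n) → Fin n
    scanMax m []       = m
    scanMax m (x ∷ xs) = if lookup F x ∧ le m x then scanMax x xs else scanMax m xs

    scanMax-∈ : ∀ m xs → lookup F m ≡ true → lookup F (scanMax m xs) ≡ true
    scanMax-∈ m []       Fm = Fm
    scanMax-∈ m (x ∷ xs) Fm with lookup F x in Fx | le m x
    ... | true  | true  = scanMax-∈ x xs Fx
    ... | true  | false = scanMax-∈ m xs Fm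
    ... | false | _     = scanMax-∈ m xs Fm

    scanMax-≥start : ∀ m xs → le m (scanMax m xs) ≡ true
    scanMax-≥start m []       = le-refl m
    scanMax-≥start m (x ∷ xs) with lookup F x | le m x in m≤x
    ... | true  | true  = le-trans m x _ m≤x (scanMax-≥start x xs)
    ... | true  | false = scanMax-≥start m xs
    ... | false | _     = scanMax-≥start m xs

    scanMax-≥ : isChain F ≡ true → ∀ m xs → lookup F m ≡ true →
                ∀ x → x ∈ xs → lookup F x ≡ true → le x (scanMax m xs) ≡ true
    scanMax-≥ F-chain m (y ∷ xs) Fm .y (here refl) Fy with lookup F y in Fy′ | le m y in m≤y
    ... | true  | true  = scanMax-≥start y xs
    ... | false | _     = ⊥-elim (true≢false Fy refl)
    ... | true  | false with ∨-true (isChain⁻ F F-chain m y Fm Fy′)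
    ...   | inj₁ m≤y′ = ⊥-elim (true≢false m≤y′ m≤y)
    ...   | inj₂ y≤m  = le-trans y m _ y≤m (scanMax-≥start m xs)
    scanMax-≥ F-chain m (y ∷ xs) Fm x (there x∈xs) Fx with lookup F y in Fy | le m y
    ... | true  | true  = scanMax-≥ F-chain y xs Fy x x∈xs Fx
    ... | true  | false = scanMax-≥ F-chain m xs Fm x x∈xs Fx
    ... | false | _     = scanMax-≥ F-chain m xs Fm x x∈xs Fx

  chain-maximum : ∀ F → isChain F ≡ true → F ⊆ᵇ ∅ᵇ ≡ false →
                  Σ (Fin n) (λ m → ∀ q → isMax F q ≡ does (q FinP.≟ m))
  chain-maximum F F-chain nonempty with ⊈∅-witness F nonempty
  ... | m₀ , Fm₀ = M , λ q → ≡-by-⇔ (λ e → dec-true (q FinP.≟ M) (max-unique q e))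
                                   (λ e → is-max q (does-true (q FinP.≟ M) e))
    where
    M = scanMax F m₀ (allFin n)
    FM = scanMax-∈ F m₀ (allFin n) Fm₀
    ≤M : ∀ x → lookup F x ≡ true → le x M ≡ true
    ≤M x Fx = scanMax-≥ F F-chain m₀ (allFin n) Fm₀ x (∈-allFin x) Fx
    max-unique : ∀ q → isMax F q ≡ true → q ≡ M
    max-unique q e = le-antisym q M (≤M q (∧-trueˡ e)) (⊆ᵇ-elim F _ (∧-trueʳ {lookup F q} e) M FM)
    is-max : ∀ q → q ≡ M → isMax F q ≡ true
    is-max q refl = ∧-true FM (⊆ᵇ-intro F _ ≤M)

  isChainIn-by-max : ∀ S F v →
    ind (isChainIn S F) v ≡ ind (F ⊆ᵇ ∅ᵇ) v + sum (λ q → ind (isChainIn S F ∧ isMax F q) v)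
  isChainIn-by-max S F v with F ⊆ᵇ ∅ᵇ in F-empty
  ... | true = begin
    ind (isChainIn S F) v                              ≡⟨ cong (λ b → ind b v) (⊆∅-isChainIn S F F-empty) ⟩
    v                                                  ≡⟨ ℤP.+-identityʳ v ⟨
    v + + 0                                            ≡⟨ cong (_+_ v) (sum-replicate-zero n) ⟨
    v + sum {n} (λ _ → + 0)                            ≡⟨ cong (_+_ v) (sum-cong-≗ no-max) ⟩
    v + sum (λ q → ind (isChainIn S F ∧ isMax F q) v)  ∎
    where
    no-max : ∀ q → + 0 ≡ ind (isChainIn S F ∧ isMax F q) v
    no-max q = sym (trans (cong (λ b → ind (isChainIn S F ∧ (b ∧ F ⊆ᵇ (λ i → le i q))) v)
                                (⊆∅-elim F F-empty q))
                          (cong (λ b → ind b v) (BoolP.∧-zeroʳ (isChainIn S F))))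
  ... | false with isChainIn S F in F-chainIn
  ...   | false = sym (trans (ℤP.+-identityˡ _) (sum-replicate-zero n))
  ...   | true  with chain-maximum F (∧-trueʳ {F ⊆ᵇ S} F-chainIn) F-empty
  ...     | m , isMax≡ = sym (trans (ℤP.+-identityˡ _)
                                    (trans (sum-cong-≗ (λ q → cong (λ b → ind b v) (isMax≡ q))) (sum-δ m v)))

  chainSum-cong : ∀ {S S′} → (∀ i → S i ≡ S′ i) → chainSum S ≡ chainSum S′
  chainSum-cong = sumOver-cong n chainWeight

  atMost : (Fin n → Bool) → Fin n → Fin n → Bool
  atMost S q i = S i ∧ le i q

  isChainIn-isMax : ∀ S F q → isChainIn S F ∧ isMax F q ≡ lookup F q ∧ isChainIn (atMost S q) F
  isChainIn-isMax S F q = trans (∧-rearrange (F ⊆ᵇ S) (isChain F) (lookup F q) _)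
    (cong (λ b → lookup F q ∧ (b ∧ isChain F)) (sym (⊆ᵇ-∧ F S (λ i → le i q))))

  below-atMost : ∀ S q i → below (atMost S q) q i ≡ below S q i
  below-atMost S q i = ≡-by-⇔
    (λ e → ∧-true (∧-trueˡ {S i} (∧-trueˡ {S i ∧ le i q} e)) (∧-trueʳ {S i ∧ le i q} e))
    (λ e → ∧-true (∧-true (∧-trueˡ {S i} e) (lt⇒le (∧-trueʳ {S i} e))) (∧-trueʳ {S i} e))

  above-atMost : ∀ S q i → above (atMost S q) q i ≡ false
  above-atMost S q i = ≢true (λ e → lt-le-asym (∧-trueʳ {S i ∧ le i q} e) (∧-trueʳ {S i} (∧-trueˡ e)))

  chainSum-through-absent : ∀ S q → S q ≡ false →
    sumSubsets n (λ F → ind (lookup F q) (ind (isChainIn S F) (sgn ∣ F ∣))) ≡ + 0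
  chainSum-through-absent S q q∉S = trans (sumSubsets-cong n vanish) (sumSubsets-zero n)
    where
    vanish : ∀ F → ind (lookup F q) (ind (isChainIn S F) (sgn ∣ F ∣)) ≡ + 0
    vanish F with lookup F q in q∈F
    ... | false = refl
    ... | true  = cong (λ b → ind b (sgn ∣ F ∣))
                       (≢true (λ e → true≢false (⊆ᵇ-elim F S (∧-trueˡ e) q q∈F) q∉S))

  chainSum-max-at : ∀ S q →
    sumSubsets n (λ F → ind (isChainIn S F ∧ isMax F q) (sgn ∣ F ∣)) ≡ - ind (S q) (chainSum (below S q))
  chainSum-max-at S q = trans
    (sumSubsets-cong n (λ F → trans (cong (λ b → ind b (sgn ∣ F ∣)) (isChainIn-isMax S F q))
                                    (ind-∧ (lookup F q) _ _)))
    (by-membership (S q) refl)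
    where
    by-membership : ∀ b → S q ≡ b →
      sumSubsets n (λ F → ind (lookup F q) (ind (isChainIn (atMost S q) F) (sgn ∣ F ∣)))
        ≡ - ind b (chainSum (below S q))
    by-membership false q∉S = chainSum-through-absent (atMost S q) q (cong (_∧ le q q) q∉S)
    by-membership true  q∈S = begin
      _ ≡⟨ chainSum-through (atMost S q) q (∧-true q∈S (le-refl q)) ⟩
      - (chainSum (below (atMost S q) q) * chainSum (above (atMost S q) q))
        ≡⟨ cong -_ (cong₂ _*_ (chainSum-cong (below-atMost S q)) (chainSum-cong (above-atMost S q))) ⟩
      - (chainSum (below S q) * chainSum ∅ᵇ)
        ≡⟨ cong (λ z → - (chainSum (below S q) * z)) chainSum-∅ ⟩
      - (chainSum (below S q) * + 1)
        ≡⟨ cong -_ (ℤP.*-identityʳ _) ⟩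
      - chainSum (below S q) ∎

  chainSum-by-max : ∀ S → chainSum S ≡ + 1 - sum (λ q → ind (S q) (chainSum (below S q)))
  chainSum-by-max S = begin
    chainSum S
      ≡⟨ sumSubsets-cong n (λ F → trans (sym (ind-∧ (F ⊆ᵇ S) (isChain F) _)) (isChainIn-by-max S F _)) ⟩
    sumSubsets n (λ F → ind (F ⊆ᵇ ∅ᵇ) (sgn ∣ F ∣) + sum (λ q → ind (isChainIn S F ∧ isMax F q) (sgn ∣ F ∣)))
      ≡⟨ sumSubsets-distrib-+ n _ _ ⟩
    sumSubsets n (λ F → ind (F ⊆ᵇ ∅ᵇ) (sgn ∣ F ∣))
      + sumSubsets n (λ F → sum (λ q → ind (isChainIn S F ∧ isMax F q) (sgn ∣ F ∣)))
      ≡⟨ cong₂ _+_ (trans (sumSubsets-⊆∅ n (λ F → sgn ∣ F ∣)) (cong sgn (SubsetP.∣⊥∣≡0 n)))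
                   (sumSubsets-comm n (λ F q → ind (isChainIn S F ∧ isMax F q) (sgn ∣ F ∣))) ⟩
    + 1 + sum (λ q → sumSubsets n (λ F → ind (isChainIn S F ∧ isMax F q) (sgn ∣ F ∣)))
      ≡⟨ cong (_+_ (+ 1)) (trans (sum-cong-≗ (chainSum-max-at S))
                                 (sum-neg (λ q → ind (S q) (chainSum (below S q))))) ⟩
    + 1 - sum (λ q → ind (S q) (chainSum (below S q))) ∎

module ChainsByMin {n : ℕ} (le : Fin n → Fin n → Bool)
  (le-refl    : ∀ i → le i i ≡ true)
  (le-antisym : ∀ i j → le i j ≡ true → le j i ≡ true → i ≡ j)
  (le-trans   : ∀ i j k → le i j ≡ true → le j k ≡ true → le i k ≡ true) where

  open Chains le le-refl le-antisym le-trans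

  private
    module Dual = Chains (λ i j → le j i) le-refl (λ i j e e′ → le-antisym i j e′ e)
                         (λ i j k e e′ → le-trans k j i e′ e)

  chainSum-dual : ∀ S → Dual.chainSum S ≡ chainSum S
  chainSum-dual S = sumSubsets-cong n (λ F → cong (λ b → ind (F ⊆ᵇ S) (ind b (sgn ∣ F ∣))) (≡-by-⇔
    (λ e → isChain⁺ F (λ i j Fi Fj → trans (BoolP.∨-comm (le i j) (le j i)) (Dual.isChain⁻ F e i j Fi Fj)))
    (λ e → Dual.isChain⁺ F (λ i j Fi Fj → trans (BoolP.∨-comm (le j i) (le i j)) (isChain⁻ F e i j Fi Fj)))))

  chainSum-by-min : ∀ S → chainSum S ≡ + 1 - sum (λ q → ind (S q) (chainSum (above S q)))
  chainSum-by-min S = begin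
    chainSum S
      ≡⟨ chainSum-dual S ⟨
    Dual.chainSum S
      ≡⟨ Dual.chainSum-by-max S ⟩
    + 1 - sum (λ q → ind (S q) (Dual.chainSum (Dual.below S q)))
      ≡⟨ cong (λ z → + 1 - z) (sum-cong-≗ (λ q →
           cong (ind (S q)) (trans (chainSum-dual _) (chainSum-cong (Dual-below≡above q))))) ⟩
    + 1 - sum (λ q → ind (S q) (chainSum (above S q))) ∎
    where
    Dual-below≡above : ∀ q i → Dual.below S q i ≡ above S q i
    Dual-below≡above q i =
      cong (λ b → S i ∧ (le q i ∧ not b)) (does-⇔ (mk⇔ sym sym) (i FinP.≟ q) (q FinP.≟ i))

∈tabulate⁻ : ∀ {n} (r : Fin n → Bool) {x} → Vec.tabulate r Vec.[ x ]= true → r x ≡ true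
∈tabulate⁻ r {x} e = trans (sym (VecP.lookup∘tabulate r x)) (VecP.[]=⇒lookup e)

∈tabulate⁺ : ∀ {n} (r : Fin n → Bool) {x} → r x ≡ true → Vec.tabulate r Vec.[ x ]= true
∈tabulate⁺ r {x} e = VecP.lookup⇒[]= x _ (trans (VecP.lookup∘tabulate r x) e)

∣tabulate∣-< : ∀ {n} (p q : Fin n → Bool) → (∀ x → p x ≡ true → q x ≡ true) →
               ∀ y → q y ≡ true → p y ≡ false → ∣ Vec.tabulate p ∣ < ∣ Vec.tabulate q ∣
∣tabulate∣-< p q p⇒q y qy py = SubsetP.p⊂q⇒∣p∣<∣q∣
  ( (λ {x} x∈p → ∈tabulate⁺ q (p⇒q x (∈tabulate⁻ p x∈p)))
  , y , ∈tabulate⁺ q qy , (λ y∈p → true≢false (∈tabulate⁻ p y∈p) py))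

∣tabulate∣-pos : ∀ {n} (q : Fin n → Bool) y → q y ≡ true → 0 < ∣ Vec.tabulate q ∣
∣tabulate∣-pos {n} q y qy = subst (_< ∣ Vec.tabulate q ∣) (SubsetP.∣⊥∣≡0 n)
  (SubsetP.p⊂q⇒∣p∣<∣q∣ ((λ x∈⊥ → ⊥-elim (SubsetP.∉⊥ x∈⊥)) , y , ∈tabulate⁺ q qy , SubsetP.∉⊥))

module GradedPosetFacts {n : ℕ} (P : GradedPoset n) where

  open GradedPoset P
  private module ≼ = IsPartialOrder isPartialOrder

  le?⇒≼ : ∀ {s t} → le? s t ≡ true → s ≼ t
  le?⇒≼ {s} {t} = does-true (s ≼? t)

  ≼⇒le? : ∀ {s t} → s ≼ t → le? s t ≡ true
  ≼⇒le? {s} {t} = dec-true (s ≼? t)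

  le?-refl : ∀ i → le? i i ≡ true
  le?-refl i = ≼⇒le? ≼.refl

  le?-antisym : ∀ i j → le? i j ≡ true → le? j i ≡ true → i ≡ j
  le?-antisym i j e e′ = ≼.antisym (le?⇒≼ e) (le?⇒≼ e′)

  le?-trans : ∀ i j k → le? i j ≡ true → le? j k ≡ true → le? i k ≡ true
  le?-trans i j k e e′ = ≼⇒le? (≼.trans (le?⇒≼ e) (le?⇒≼ e′))

  open Chains le? le?-refl le?-antisym le?-trans public
  open ChainsByMin le? le?-refl le?-antisym le?-trans public

  lt⇒≺ : ∀ {s t} → lt s t ≡ true → s ≺ t
  lt⇒≺ e = le?⇒≼ (lt⇒le e) , lt⇒≢ e

  ≺⇒lt : ∀ {s t} → s ≺ t → lt s t ≡ true
  ≺⇒lt (s≼t , s≢t) = le⇒lt (≼⇒le? s≼t) s≢t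

  lt-trans : ∀ {i j k} → lt i j ≡ true → lt j k ≡ true → lt i k ≡ true
  lt-trans {i} {j} {k} e e′ = le⇒lt (le?-trans i j k (lt⇒le e) (lt⇒le e′))
                                    (λ { refl → lt-le-asym e (lt⇒le e′) })

  intervalSize : Fin n → Fin n → ℕ
  intervalSize s t = ∣ Vec.tabulate (λ u → le? s u ∧ le? u t) ∣

  intervalSize-shrinkʳ : ∀ {s u t} → le? s u ≡ true → lt u t ≡ true → intervalSize s u < intervalSize s t
  intervalSize-shrinkʳ {s} {u} {t} s≤u u<t = ∣tabulate∣-< _ _
    (λ x e → ∧-true (∧-trueˡ e) (le?-trans x u t (∧-trueʳ {le? s x} e) (lt⇒le u<t)))
    t (∧-true (le?-trans s u t s≤u (lt⇒le u<t)) (le?-refl t))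
    (≢true (λ e → lt-le-asym u<t (∧-trueʳ {le? s t} e)))

  intervalSize-shrinkˡ : ∀ {s u t} → lt s u ≡ true → le? u t ≡ true → intervalSize u t < intervalSize s t
  intervalSize-shrinkˡ {s} {u} {t} s<u u≤t = ∣tabulate∣-< _ _
    (λ x e → ∧-true (le?-trans s u x (lt⇒le s<u) (∧-trueˡ e)) (∧-trueʳ {le? u x} e))
    s (∧-true (le?-refl s) (le?-trans s u t (lt⇒le s<u) u≤t))
    (≢true (λ e → lt-le-asym s<u (∧-trueˡ e)))

  intervalSize-pos : ∀ {s t} → le? s t ≡ true → 0 < intervalSize s t
  intervalSize-pos {s} {t} s≤t = ∣tabulate∣-pos _ s (∧-true (le?-refl s) s≤t)

  intervalSize-≤ : ∀ s t → intervalSize s t ≤ n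
  intervalSize-≤ s t = SubsetP.∣p∣≤n (Vec.tabulate (λ u → le? s u ∧ le? u t))

  private
    fuel-pred : ∀ {a b k} → a < b → b ≤ suc k → a ≤ k
    fuel-pred a<b b≤ = ℕP.≤-pred (ℕP.≤-trans a<b b≤)

  ρ-strictMono-fuel : ∀ k s t → intervalSize s t ≤ k → lt s t ≡ true → ρ s < ρ t
  ρ-strictMono-fuel zero    s t size≤ s<t = ⊥-elim (ℕP.<⇒≱ (intervalSize-pos (lt⇒le s<t)) size≤)
  ρ-strictMono-fuel (suc k) s t size≤ s<t
    with FinP.any? (λ u → (lt s u ∧ lt u t) Data.Bool.≟ true)
  ... | yes (u , s<u<t) = ℕP.<-trans
        (ρ-strictMono-fuel k s u (fuel-pred (intervalSize-shrinkʳ (lt⇒le s<u) u<t) size≤) s<u)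
        (ρ-strictMono-fuel k u t (fuel-pred (intervalSize-shrinkˡ s<u (lt⇒le u<t)) size≤) u<t)
    where
    s<u = ∧-trueˡ s<u<t
    u<t = ∧-trueʳ {lt s u} s<u<t
  ... | no no-middle = ℕP.≤-reflexive (sym (ρ-cover s t (lt⇒≺ s<t ,
        λ { (u , s≺u , u≺t) → no-middle (u , ∧-true (≺⇒lt s≺u) (≺⇒lt u≺t)) })))

  ρ-strictMono : ∀ {s t} → lt s t ≡ true → ρ s < ρ t
  ρ-strictMono {s} {t} = ρ-strictMono-fuel n s t (intervalSize-≤ s t)

  mobF-diag : ∀ k s → 0 < k → mobF k s s ≡ + 1
  mobF-diag (suc k) s _ rewrite dec-true (s FinP.≟ s) refl = refl

  mobF-step : ∀ k s t → s ≺ t →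
    mobF (suc k) s t ≡ - sumℤ (map (mobF k s) (filterᵇ (λ u → le? s u ∧ lt u t) (allFin n)))
  mobF-step k s t (s≼t , s≢t) with s FinP.≟ t | s ≼? t
  ... | yes s≡t | _     = ⊥-elim (s≢t s≡t)
  ... | no _    | yes _ = refl
  ... | no _    | no s⋠t = ⊥-elim (s⋠t s≼t)

  openInterval : Fin n → Fin n → Fin n → Bool
  openInterval s t i = lt s i ∧ lt i t

  μ-hall-fuel : ∀ k s t → intervalSize s t ≤ k → lt s t ≡ true → mobF k s t ≡ - chainSum (openInterval s t)

  μ-hall-term : ∀ k s t → intervalSize s t ≤ suc k → lt s t ≡ true → ∀ u →
    ind (le? s u ∧ lt u t) (mobF k s u)
      ≡ ind (does (u FinP.≟ s)) (+ 1) + - ind (openInterval s t u) (chainSum (below (openInterval s t) u))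
  μ-hall-term k s t size≤ s<t u with u FinP.≟ s
  ... | yes refl rewrite dec-true (s FinP.≟ s) refl | le?-refl s | s<t = mobF-diag k s (fuel-pred 1<size size≤)
    where
    -- [s, t] contains s and t, so the remaining fuel k is positive
    1<size : 1 < intervalSize s t
    1<size = ℕP.≤-<-trans (intervalSize-pos (le?-refl s)) (intervalSize-shrinkʳ (le?-refl s) s<t)
  ... | no u≢s with le? s u ∧ lt u t in s≤u<t
  ...   | false = sym (cong (λ b → + 0 + - ind b (chainSum (below (openInterval s t) u))) not-inside)
    where
    not-inside : openInterval s t u ≡ false
    not-inside = ≢true (λ e → true≢false (∧-true (lt⇒le (∧-trueˡ e)) (∧-trueʳ {lt s u} e)) s≤u<t)
  ...   | true  = begin
    mobF k s u
      ≡⟨ μ-hall-fuel k s u (fuel-pred (intervalSize-shrinkʳ (∧-trueˡ s≤u<t) u<t) size≤) s<u ⟩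
    - chainSum (openInterval s u)
      ≡⟨ cong -_ (chainSum-cong (λ i → sym (below-open i))) ⟩
    - ind true (chainSum (below (openInterval s t) u))
      ≡⟨ cong (λ b → - ind b (chainSum (below (openInterval s t) u))) (sym (∧-true s<u u<t)) ⟩
    - ind (openInterval s t u) (chainSum (below (openInterval s t) u))
      ≡⟨ ℤP.+-identityˡ _ ⟨
    + 0 + - ind (openInterval s t u) (chainSum (below (openInterval s t) u)) ∎
    where
    u<t = ∧-trueʳ {le? s u} s≤u<t
    s<u = le⇒lt (∧-trueˡ s≤u<t) (u≢s ∘ sym)
    below-open : ∀ i → below (openInterval s t) u i ≡ openInterval s u i
    below-open i = ≡-by-⇔
      (λ e → ∧-true (∧-trueˡ {lt s i} (∧-trueˡ {openInterval s t i} e)) (∧-trueʳ {openInterval s t i} e))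
      (λ e → ∧-true (∧-true (∧-trueˡ {lt s i} e) (lt-trans (∧-trueʳ {lt s i} e) u<t)) (∧-trueʳ {lt s i} e))

  μ-hall-fuel zero    s t size≤ s<t = ⊥-elim (ℕP.<⇒≱ (intervalSize-pos (lt⇒le s<t)) size≤)
  μ-hall-fuel (suc k) s t size≤ s<t = begin
    mobF (suc k) s t
      ≡⟨ mobF-step k s t (lt⇒≺ s<t) ⟩
    - sumℤ (map (mobF k s) (filterᵇ (λ u → le? s u ∧ lt u t) (allFin n)))
      ≡⟨ cong -_ (sumℤ-filter-allFin (λ u → le? s u ∧ lt u t) (mobF k s)) ⟩
    - sum (λ u → ind (le? s u ∧ lt u t) (mobF k s u))
      ≡⟨ cong -_ (sum-cong-≗ (μ-hall-term k s t size≤ s<t)) ⟩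
    - sum (λ u → ind (does (u FinP.≟ s)) (+ 1) + - ind (O u) (chainSum (below O u)))
      ≡⟨ cong -_ (trans (∑-distrib-+ (λ u → ind (does (u FinP.≟ s)) (+ 1)) _)
                        (cong₂ _+_ (sum-δ s (+ 1)) (sum-neg (λ u → ind (O u) (chainSum (below O u)))))) ⟩
    - (+ 1 - sum (λ u → ind (O u) (chainSum (below O u))))
      ≡⟨ cong -_ (chainSum-by-max O) ⟨
    - chainSum O ∎
    where O = openInterval s t

  μ-hall : ∀ {s t} → lt s t ≡ true → μ s t ≡ - chainSum (openInterval s t)
  μ-hall {s} {t} = μ-hall-fuel n s t (intervalSize-≤ s t)

  proper : Fin n → Bool
  proper i = not (does (i FinP.≟ bot)) ∧ not (does (i FinP.≟ top))

  orderComplex-isChainIn : ∀ F → orderComplex P F ≡ isChainIn proper F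
  orderComplex-isChainIn F = ≡-by-⇔
    (λ e → ∧-true (⊆ᵇ-intro F proper (λ i Fi → ∧-trueˡ (vertex e i Fi)))
                  (allB-allFin⁺ _ (λ i → implies (lookup F i) (λ Fi → ∧-trueʳ {proper i} (vertex e i Fi)))))
    (λ e → allB-allFin⁺ _ (λ i → implies (lookup F i) (λ Fi →
             trans (sym (BoolP.∧-assoc (not (does (i FinP.≟ bot))) _ _))
                   (∧-true (⊆ᵇ-elim F proper (∧-trueˡ e) i Fi)
                           (implied (allB-allFin⁻ _ (∧-trueʳ {F ⊆ᵇ proper} e) i) Fi)))))
    where
    vertex : orderComplex P F ≡ true → ∀ i → lookup F i ≡ true → proper i ∧ comparableWithin F i ≡ true
    vertex e i Fi = trans (BoolP.∧-assoc (not (does (i FinP.≟ bot))) _ _) (implied (allB-allFin⁻ _ e i) Fi)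

  redEuler-orderComplex : redEuler (orderComplex P) ≡ - chainSum proper
  redEuler-orderComplex = begin
    redEuler (orderComplex P)
      ≡⟨ redEuler-sumSubsets (orderComplex P) ⟩
    sumSubsets n (λ F → ind (orderComplex P F) (sgn (suc ∣ F ∣)))
      ≡⟨ sumSubsets-cong n (λ F → begin
           ind (orderComplex P F) (sgn (suc ∣ F ∣))
             ≡⟨ cong₂ ind (orderComplex-isChainIn F) (sgn-suc ∣ F ∣) ⟩
           ind (F ⊆ᵇ proper ∧ isChain F) (- sgn ∣ F ∣)
             ≡⟨ trans (ind-∧ (F ⊆ᵇ proper) _ _) (cong (ind (F ⊆ᵇ proper)) (ind-neg (isChain F) _)) ⟩
           ind (F ⊆ᵇ proper) (- chainWeight F)
             ≡⟨ ind-neg (F ⊆ᵇ proper) _ ⟩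
           - ind (F ⊆ᵇ proper) (chainWeight F) ∎) ⟩
    sumSubsets n (λ F → - ind (F ⊆ᵇ proper) (chainWeight F))
      ≡⟨ sumSubsets-neg n _ ⟩
    - chainSum proper ∎

  redEuler-lk : ∀ q → proper q ≡ true →
    redEuler (lk (orderComplex P) q) ≡ - (chainSum (below proper q) * chainSum (above proper q))
  redEuler-lk q q-proper = begin
    redEuler (lk (orderComplex P) q)
      ≡⟨ redEuler-sumSubsets (lk (orderComplex P) q) ⟩
    sumSubsets n (λ G → ind (not (lookup G q) ∧ orderComplex P (G ∪ ⁅ q ⁆)) (sgn (suc ∣ G ∣)))
      ≡⟨ sumSubsets-cong n (λ G → trans (ind-∧ (not (lookup G q)) _ _) (ind-cong (not (lookup G q)) (λ q∉G →
           cong₂ ind (orderComplex-isChainIn (G ∪ ⁅ q ⁆)) (cong sgn (sym (∣∪⁅⁆∣ G q (not-true q∉G))))))) ⟩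
    sumSubsets n (λ G → ind (not (lookup G q)) (ind (isChainIn proper (G ∪ ⁅ q ⁆)) (sgn ∣ G ∪ ⁅ q ⁆ ∣)))
      ≡⟨ sumSubsets-∋ n q _ ⟨
    sumSubsets n (λ F → ind (lookup F q) (ind (isChainIn proper F) (sgn ∣ F ∣)))
      ≡⟨ chainSum-through proper q q-proper ⟩
    - (chainSum (below proper q) * chainSum (above proper q)) ∎

  bot≤ : ∀ i → le? bot i ≡ true
  bot≤ i = ≼⇒le? (bot-least i)

  ≤top : ∀ i → le? i top ≡ true
  ≤top i = ≼⇒le? (top-great i)

  proper-≢bot : ∀ {i} → proper i ≡ true → i ≢ bot
  proper-≢bot {i} e = does-false (i FinP.≟ bot) (not-true (∧-trueˡ e))

  proper-≢top : ∀ {i} → proper i ≡ true → i ≢ top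
  proper-≢top {i} e = does-false (i FinP.≟ top) (not-true (∧-trueʳ {not (does (i FinP.≟ bot))} e))

  proper⁺ : ∀ {i} → i ≢ bot → i ≢ top → proper i ≡ true
  proper⁺ {i} i≢bot i≢top = ∧-true (not-false (dec-false (i FinP.≟ bot) i≢bot))
                                   (not-false (dec-false (i FinP.≟ top) i≢top))

  bot<proper : ∀ {q} → proper q ≡ true → lt bot q ≡ true
  bot<proper {q} e = le⇒lt (bot≤ q) (proper-≢bot e ∘ sym)

  proper<top : ∀ {q} → proper q ≡ true → lt q top ≡ true
  proper<top {q} e = le⇒lt (≤top q) (proper-≢top e)

  below-proper : ∀ q i → below proper q i ≡ openInterval bot q i
  below-proper q i = ≡-by-⇔
    (λ e → ∧-true (bot<proper (∧-trueˡ e)) (∧-trueʳ {proper i} e))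
    (λ e → let bot<i = ∧-trueˡ {lt bot i} e
               i<q   = ∧-trueʳ {lt bot i} e
           in ∧-true (proper⁺ (lt⇒≢ bot<i ∘ sym) (λ { refl → lt-le-asym i<q (≤top q) })) i<q)

  above-proper : ∀ q i → above proper q i ≡ openInterval q top i
  above-proper q i = ≡-by-⇔
    (λ e → ∧-true (∧-trueʳ {proper i} e) (proper<top (∧-trueˡ e)))
    (λ e → let q<i   = ∧-trueˡ {lt q i} e
               i<top = ∧-trueʳ {lt q i} e
           in ∧-true (proper⁺ (λ { refl → lt-le-asym q<i (bot≤ q) }) (lt⇒≢ i<top)) q<i)

  chainSum-below-proper : ∀ {q} → proper q ≡ true → chainSum (below proper q) ≡ - μ bot q
  chainSum-below-proper {q} q-proper = begin
    chainSum (below proper q)       ≡⟨ chainSum-cong (below-proper q) ⟩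
    chainSum (openInterval bot q)   ≡⟨ ℤP.neg-involutive _ ⟨
    - - chainSum (openInterval bot q) ≡⟨ cong -_ (μ-hall (bot<proper q-proper)) ⟨
    - μ bot q                       ∎

  chainSum-above-proper : ∀ {q} → proper q ≡ true → chainSum (above proper q) ≡ - μ q top
  chainSum-above-proper {q} q-proper = begin
    chainSum (above proper q)       ≡⟨ chainSum-cong (above-proper q) ⟩
    chainSum (openInterval q top)   ≡⟨ ℤP.neg-involutive _ ⟨
    - - chainSum (openInterval q top) ≡⟨ cong -_ (μ-hall (proper<top q-proper)) ⟨
    - μ q top                       ∎

  twice-redEuler+1 : + 2 * (redEuler (orderComplex P) + + 1)
    ≡ sum (λ q → ind (proper q) (chainSum (below proper q) + chainSum (above proper q)))
  twice-redEuler+1 = begin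
    + 2 * (redEuler (orderComplex P) + + 1)
      ≡⟨ cong (λ z → + 2 * (z + + 1)) redEuler-orderComplex ⟩
    + 2 * (- chainSum proper + + 1)
      ≡⟨ double (- chainSum proper + + 1) ⟩
    (- chainSum proper + + 1) + (- chainSum proper + + 1)
      ≡⟨ cong₂ _+_ (trans (cong (λ z → - z + + 1) (chainSum-by-max proper)) (cancel (sum lower)))
                   (trans (cong (λ z → - z + + 1) (chainSum-by-min proper)) (cancel (sum upper))) ⟩
    sum lower + sum upper
      ≡⟨ trans (sum-cong-≗ (λ q → ind-+ (proper q) _ _)) (∑-distrib-+ lower upper) ⟨
    sum (λ q → ind (proper q) (chainSum (below proper q) + chainSum (above proper q))) ∎
    where
    lower upper : Fin n → ℤ
    lower q = ind (proper q) (chainSum (below proper q))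
    upper q = ind (proper q) (chainSum (above proper q))
    double : ∀ x → + 2 * x ≡ x + x
    double = solve-∀
    cancel : ∀ x → - (+ 1 - x) + + 1 ≡ x
    cancel = solve-∀

complement-bound : ∀ r d → 2 ≤ r → r ≤ d → (suc d ∸ r) ℕ.+ 1 ≤ d
complement-bound (suc (suc r)) (suc d) (s≤s (s≤s z≤n)) (s≤s r<d) =
  subst (_≤ suc d) (ℕP.+-comm 1 (d ∸ r)) (s≤s (ℕP.m∸n≤m d r))

module OddRankOneSing {n : ℕ} (P : GradedPoset n) (d : ℕ)
  (ρ-top    : GradedPoset.ρ P (GradedPoset.top P) ≡ suc d)
  (odd-rank : suc d % 2 ≡ 1)
  (one-sing : GradedPoset.OneSing P d) where

  open GradedPoset P
  open GradedPosetFacts P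
  private module ≼ = IsPartialOrder isPartialOrder

  μ-bot-Eulerian : ∀ {q} → ρ q ℕ.+ 1 ≤ d → μ bot q ≡ sgn (ρ q)
  μ-bot-Eulerian {q} short = subst (λ r → μ bot q ≡ sgn (ρ q ∸ r)) ρ-bot
    (one-sing bot q (bot-least q) (subst (λ r → (ρ q ∸ r) ℕ.+ 1 ≤ d) (sym ρ-bot) short)
              bot q ≼.refl (bot-least q) ≼.refl)

  μ-top-Eulerian : ∀ {q} → (suc d ∸ ρ q) ℕ.+ 1 ≤ d → μ q top ≡ sgn (suc d ∸ ρ q)
  μ-top-Eulerian {q} short = subst (λ r → μ q top ≡ sgn (r ∸ ρ q)) ρ-top
    (one-sing q top (top-great q) (subst (λ r → (r ∸ ρ q) ℕ.+ 1 ≤ d) (sym ρ-top) short)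
              q top ≼.refl (top-great q) ≼.refl)

  module _ {q : Fin n} (q-proper : proper q ≡ true) where

    1≤ρ : 1 ≤ ρ q
    1≤ρ = subst (_< ρ q) ρ-bot (ρ-strictMono (bot<proper q-proper))

    ρ≤d : ρ q ≤ d
    ρ≤d = ℕP.≤-pred (subst (ρ q <_) ρ-top (ρ-strictMono (proper<top q-proper)))

    sgn-complement : sgn (ρ q) * sgn (suc d ∸ ρ q) ≡ - (+ 1)
    sgn-complement = trans (sym (sgn-+ (ρ q) _))
                           (trans (cong sgn (ℕP.m+[n∸m]≡n (ℕP.m≤n⇒m≤1+n ρ≤d))) (sgn-odd (suc d) odd-rank))

    below-value : ρ q ≢ d → chainSum (below proper q) ≡ - sgn (ρ q)
    below-value ρ≢d = trans (chainSum-below-proper q-proper) (cong -_ (μ-bot-Eulerian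
      (subst (_≤ d) (ℕP.+-comm 1 (ρ q)) (ℕP.≤∧≢⇒< ρ≤d ρ≢d))))

    above-value : ρ q ≢ 1 → chainSum (above proper q) ≡ - sgn (suc d ∸ ρ q)
    above-value ρ≢1 = trans (chainSum-above-proper q-proper) (cong -_ (μ-top-Eulerian
      (complement-bound (ρ q) d (ℕP.≤∧≢⇒< 1≤ρ (ρ≢1 ∘ sym)) ρ≤d)))

    one-side-unit : chainSum (below proper q) ≡ + 1 ⊎ chainSum (above proper q) ≡ + 1
    one-side-unit with sgn-±1 (ρ q)
    ... | inj₁ sgn≡1  = inj₂ (trans (above-value ρ≢1) (cong -_ complement≡-1))
      where
      ρ≢1 : ρ q ≢ 1
      ρ≢1 ρ≡1 with trans (sym sgn≡1) (cong sgn ρ≡1)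
      ... | ()
      complement≡-1 : sgn (suc d ∸ ρ q) ≡ - (+ 1)
      complement≡-1 = trans (sym (ℤP.*-identityˡ _))
                            (trans (cong (_* sgn (suc d ∸ ρ q)) (sym sgn≡1)) sgn-complement)
    ... | inj₂ sgn≡-1 = inj₁ (trans (below-value ρ≢d) (cong -_ sgn≡-1))
      where
      ρ≢d : ρ q ≢ d
      ρ≢d ρ≡d with trans (sym sgn-complement)
                         (cong₂ _*_ sgn≡-1 (trans (cong (λ r → sgn (suc d ∸ r)) ρ≡d)
                                                  (cong sgn (ℕP.m+n∸n≡m 1 d))))
      ... | ()

    inner-product : ρ q ≢ 1 → ρ q ≢ d → chainSum (below proper q) * chainSum (above proper q) ≡ - (+ 1)
    inner-product ρ≢1 ρ≢d = begin
      chainSum (below proper q) * chainSum (above proper q)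
        ≡⟨ cong₂ _*_ (below-value ρ≢d) (above-value ρ≢1) ⟩
      - sgn (ρ q) * - sgn (suc d ∸ ρ q)
        ≡⟨ neg-*-neg (sgn (ρ q)) _ ⟩
      sgn (ρ q) * sgn (suc d ∸ ρ q)
        ≡⟨ sgn-complement ⟩
      - (+ 1) ∎

  rankOneOrD? : Fin n → Bool
  rankOneOrD? q =
    not (does (q FinP.≟ bot)) ∧ not (does (q FinP.≟ top)) ∧ (does (ρ q ℕ.≟ 1) ∨ does (ρ q ℕ.≟ d))

  vertex-term : ∀ q →
    ind (proper q) (chainSum (below proper q) + chainSum (above proper q))
      ≡ ind (rankOneOrD? q) (+ 1) - ind (rankOneOrD? q) (redEuler (lk (orderComplex P) q))
  vertex-term q with not (does (q FinP.≟ bot)) in ≢bot | not (does (q FinP.≟ top)) in ≢top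
  ... | false | _     = refl
  ... | true  | false = refl
  ... | true  | true  with does (ρ q ℕ.≟ 1) ∨ does (ρ q ℕ.≟ d) in one-or-d
  ...   | true  = begin
    chainSum (below proper q) + chainSum (above proper q)
      ≡⟨ +-unit-side _ _ (one-side-unit q-proper) ⟩
    + 1 + chainSum (below proper q) * chainSum (above proper q)
      ≡⟨ cong (_+_ (+ 1)) (ℤP.neg-involutive (chainSum (below proper q) * chainSum (above proper q))) ⟨
    + 1 - - (chainSum (below proper q) * chainSum (above proper q))
      ≡⟨ cong (λ z → + 1 - z) (redEuler-lk q q-proper) ⟨
    + 1 - redEuler (lk (orderComplex P) q) ∎
    where q-proper = ∧-true ≢bot ≢top
  ...   | false = trans (+-unit-side _ _ (one-side-unit q-proper))
                        (cong (_+_ (+ 1)) (inner-product q-proper (ρ≢ 1 (BoolP.∨-conicalˡ _ _ one-or-d))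
                                                                   (ρ≢ d (BoolP.∨-conicalʳ _ _ one-or-d))))
    where
    q-proper = ∧-true ≢bot ≢top
    ρ≢ : ∀ k → does (ρ q ℕ.≟ k) ≡ false → ρ q ≢ k
    ρ≢ k = does-false (ρ q ℕ.≟ k)

corollary5p9 : ∀ {n} (P : GradedPoset n) (d : ℕ) →
    GradedPoset.ρ P (GradedPoset.top P) ≡ suc d →
    suc d % 2 ≡ 1 →
    GradedPoset.OneSing P d →
    (+ 2) * (redEuler (orderComplex P) + (+ 1))
      ≡ (+ length (rankOneOrD P d))
        - sumℤ (map (λ q → redEuler (lk (orderComplex P) q)) (rankOneOrD P d))
corollary5p9 {n} P d ρ-top odd-rank one-sing = begin
  + 2 * (redEuler Γ + + 1)
    ≡⟨ twice-redEuler+1 ⟩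
  sum (λ q → ind (proper q) (chainSum (below proper q) + chainSum (above proper q)))
    ≡⟨ sum-cong-≗ vertex-term ⟩
  sum (λ q → counted q - linkEuler q)
    ≡⟨ trans (∑-distrib-+ counted (λ q → - linkEuler q)) (cong (_+_ (sum counted)) (sum-neg linkEuler)) ⟩
  sum counted - sum linkEuler
    ≡⟨ cong₂ _-_ (length-filter-allFin rankOneOrD?)
                 (sumℤ-filter-allFin rankOneOrD? (λ q → redEuler (lk Γ q))) ⟨
  + length (rankOneOrD P d) - sumℤ (map (λ q → redEuler (lk Γ q)) (rankOneOrD P d)) ∎
  where
  open OddRankOneSing P d ρ-top odd-rank one-sing
  open GradedPosetFacts P
  Γ = orderComplex P
  counted linkEuler : Fin n → ℤ
  counted q   = ind (rankOneOrD? q) (+ 1)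
  linkEuler q = ind (rankOneOrD? q) (redEuler (lk Γ q))
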